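{- Let $\gamma,\delta\in\mathcal{M}^0_{1,3}$. Then $\Psi_{\gamma\circ\delta}=\Psi_\gamma\circ\Psi_\delta$.
   Context: Let $\psi_1: 0\mapsto 01,\ 1\mapsto 0$ and $\psi_3: 0\mapsto 0,\ 1\mapsto 01$ be morphisms of $\{0,1\}^*$, $\mathcal{M}_{1,3}$ the monoid under composition they generate, and $\mathcal{M}^0_{1,3}$ the set of $\gamma\in\mathcal{M}_{1,3}$ such that the word $\gamma(0)$ ends with the letter $0$ (this set is closed under composition). For $\gamma\in\mathcal{M}^0_{1,3}$ let $u$ be the word $\gamma(0)$ with its final letter $0$ deleted (so $\gamma(0)=u0$); then $u$ is also a prefix of $\gamma(1)$, and $\Psi_\gamma$ denotes the morphism conjugate to $\gamma$ by $u$, i.e. the unique morphism with $u\,\Psi_\gamma(a)=\gamma(a)\,u$ for $a\in\{0,1\}$. Explicitly, if $\gamma(0)=u0$ and $\gamma(1)=u0v$ then $\Psi_\gamma(0)=0u$ and $\Psi_\gamma(1)=0vu$. -}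

module Defs where

open import Data.List using (List; []; _∷_; _++_; concatMap; length; drop; reverse)
open import Data.Product using (Σ; _×_; _,_)
open import Relation.Binary.PropositionalEquality using (_≡_)

data Letter : Set where
  𝟘 𝟙 : Letter

Word : Set
Word = List Letter

-- A morphism of {0,1}^* is determined by the images of the letters.
Morphism : Set
Morphism = Letter → Word

apply : Morphism → Word → Word
apply f w = concatMap f w

_∘ₘ_ : Morphism → Morphism → Morphism
(f ∘ₘ g) a = apply f (g a)

idₘ : Morphism
idₘ a = a ∷ []

ψ₁ : Morphism
ψ₁ 𝟘 = 𝟘 ∷ 𝟙 ∷ []
ψ₁ 𝟙 = 𝟘 ∷ []

ψ₃ : Morphism
ψ₃ 𝟘 = 𝟘 ∷ []
ψ₃ 𝟙 = 𝟘 ∷ 𝟙 ∷ []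

data Gen : Set where
  g₁ g₃ : Gen

gen : Gen → Morphism
gen g₁ = ψ₁
gen g₃ = ψ₃

-- Every element of M_{1,3} is the composite of a finite list of generators
-- (the empty list is the identity).
eval : List Gen → Morphism
eval []       = idₘ
eval (g ∷ gs) = gen g ∘ₘ eval gs

-- Membership in M_{1,3}: being equal (on both letters) to such a composite.
InM13 : Morphism → Set
InM13 f = Σ (List Gen) λ gs → (eval gs 𝟘 ≡ f 𝟘) × (eval gs 𝟙 ≡ f 𝟙)

EndsWith0 : Word → Set
EndsWith0 w = Σ Word λ u → w ≡ u ++ (𝟘 ∷ [])

InM13⁰ : Morphism → Set
InM13⁰ f = InM13 f × EndsWith0 (f 𝟘)

prefixU : Morphism → Word
prefixU f = reverse (drop 1 (reverse (f 𝟘)))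

-- Ψ_γ: the morphism conjugate to γ by u, i.e. Ψ_γ(a) is the (unique) word w
-- with u w = γ(a) u; it is obtained by deleting the first |u| letters of γ(a) u.
Ψ : Morphism → Morphism
Ψ f a = drop (length (prefixU f)) (f a ++ prefixU f)

module Submission where

-- Call a morphism f *conjugate by p* to g when f(a) p = p g(a)
-- for every letter a; by definition Ψ_f is the conjugate of f by its own
-- prefix u = prefixU f, whenever such a conjugate exists, and a conjugate by
-- a given word is unique (cancel p on the left).  This rests on the
--     invariant "f(0) = u c and u is a prefix of f(1) u", proved by induction
--     along the generator list, using only that ψ₁ and ψ₃ send each letter to
--     0 or to 0b;
--   * if δ(0) ends with 0 and γ(0) is non-empty, then
--     prefixU (γ ∘ δ) = γ(prefixU δ) prefixU γ.
-- Hence γ ∘ δ is conjugate by its own prefix to Ψ_γ ∘ Ψ_δ, and uniqueness of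
-- conjugates gives Ψ_{γ∘δ} = Ψ_γ ∘ Ψ_δ.

open import Defs
open import Data.List using (List; []; _∷_; _++_; length; drop; reverse)
open import Data.List.Properties using (++-assoc; ++-identityʳ; concatMap-++; reverse-++; reverse-involutive)
open import Data.Product using (Σ; _×_; _,_)
open import Data.Sum using (_⊎_; inj₁; inj₂)
open import Relation.Binary.PropositionalEquality using (_≡_; refl; sym; trans; cong; cong₂; subst; module ≡-Reasoning)

open ≡-Reasoning

drop-length-++ : (p s : Word) → drop (length p) (p ++ s) ≡ s
drop-length-++ []      s = refl
drop-length-++ (x ∷ p) s = drop-length-++ p s

prefixU-∷ʳ : {f : Morphism} {u : Word} {c : Letter} →
             f 𝟘 ≡ u ++ c ∷ [] → prefixU f ≡ u
prefixU-∷ʳ {f} {u} {c} f0≡uc = begin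
  reverse (drop 1 (reverse (f 𝟘)))         ≡⟨ cong (λ w → reverse (drop 1 (reverse w))) f0≡uc ⟩
  reverse (drop 1 (reverse (u ++ c ∷ []))) ≡⟨ cong (λ w → reverse (drop 1 w)) (reverse-++ u (c ∷ [])) ⟩
  reverse (reverse u)                       ≡⟨ reverse-involutive u ⟩
  u                                         ∎

apply-++ : (f : Morphism) (x y : Word) → apply f (x ++ y) ≡ apply f x ++ apply f y
apply-++ f = concatMap-++ f

apply-∷ʳ : (f : Morphism) (u : Word) (c : Letter) → apply f (u ++ c ∷ []) ≡ apply f u ++ f c
apply-∷ʳ f u c = trans (apply-++ f u (c ∷ [])) (cong (apply f u ++_) (++-identityʳ (f c)))

apply-preserves-++ : (f : Morphism) {x y z w : Word} → x ++ y ≡ z ++ w →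
                     apply f x ++ apply f y ≡ apply f z ++ apply f w
apply-preserves-++ f {x} {y} {z} {w} xy≡zw = begin
  apply f x ++ apply f y ≡⟨ sym (apply-++ f x y) ⟩
  apply f (x ++ y)       ≡⟨ cong (apply f) xy≡zw ⟩
  apply f (z ++ w)       ≡⟨ apply-++ f z w ⟩
  apply f z ++ apply f w ∎

Conjugate : Morphism → Word → Morphism → Set
Conjugate f p g = (a : Letter) → f a ++ p ≡ p ++ g a

conjugate-apply : {f g : Morphism} {p : Word} → Conjugate f p g →
                  (w : Word) → apply f w ++ p ≡ p ++ apply g w
conjugate-apply {f} {g} {p} conj []      = sym (++-identityʳ p)
conjugate-apply {f} {g} {p} conj (a ∷ w) = begin
  (f a ++ apply f w) ++ p   ≡⟨ ++-assoc (f a) (apply f w) p ⟩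
  f a ++ (apply f w ++ p)   ≡⟨ cong (f a ++_) (conjugate-apply conj w) ⟩
  f a ++ (p ++ apply g w)   ≡⟨ sym (++-assoc (f a) p (apply g w)) ⟩
  (f a ++ p) ++ apply g w   ≡⟨ cong (_++ apply g w) (conj a) ⟩
  (p ++ g a) ++ apply g w   ≡⟨ ++-assoc p (g a) (apply g w) ⟩
  p ++ (g a ++ apply g w)   ∎

conjugate-∘ : {f f′ g g′ : Morphism} {p q : Word} →
              Conjugate f p f′ → Conjugate g q g′ →
              Conjugate (f ∘ₘ g) (apply f q ++ p) (f′ ∘ₘ g′)
conjugate-∘ {f} {f′} {g} {g′} {p} {q} conj-f conj-g a = begin
  apply f (g a) ++ (apply f q ++ p)     ≡⟨ sym (++-assoc (apply f (g a)) (apply f q) p) ⟩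
  (apply f (g a) ++ apply f q) ++ p     ≡⟨ cong (_++ p) (apply-preserves-++ f {g a} {q} {q} {g′ a} (conj-g a)) ⟩
  (apply f q ++ apply f (g′ a)) ++ p    ≡⟨ ++-assoc (apply f q) (apply f (g′ a)) p ⟩
  apply f q ++ (apply f (g′ a) ++ p)    ≡⟨ cong (apply f q ++_) (conjugate-apply conj-f (g′ a)) ⟩
  apply f q ++ (p ++ apply f′ (g′ a))   ≡⟨ sym (++-assoc (apply f q) p (apply f′ (g′ a))) ⟩
  (apply f q ++ p) ++ apply f′ (g′ a)   ∎

conjugate-unique : {f g : Morphism} {p : Word} → Conjugate f p g →
                   (a : Letter) → drop (length p) (f a ++ p) ≡ g a
conjugate-unique {f} {g} {p} conj a =
  trans (cong (drop (length p)) (conj a)) (drop-length-++ p (g a))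

PrefixOfImages : Morphism → Word → Set
PrefixOfImages f p = (a : Letter) → Σ Word λ s → f a ++ p ≡ p ++ s

conjugate-of-prefix : {f : Morphism} {p : Word} → PrefixOfImages f p →
                      Conjugate f p (λ a → drop (length p) (f a ++ p))
conjugate-of-prefix {f} {p} prefix a with prefix a
... | s , fap≡ps = begin
  f a ++ p                              ≡⟨ fap≡ps ⟩
  p ++ s                                ≡⟨ cong (p ++_) (sym (drop-length-++ p s)) ⟩
  p ++ drop (length p) (p ++ s)         ≡⟨ cong (λ w → p ++ drop (length p) w) (sym fap≡ps) ⟩
  p ++ drop (length p) (f a ++ p)       ∎

Balanced : Morphism → Set
Balanced f = Σ Word λ u → Σ Letter λ c → (f 𝟘 ≡ u ++ c ∷ []) × (Σ Word λ s → f 𝟙 ++ u ≡ u ++ s)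

ZeroLed : Morphism → Set
ZeroLed ψ = (a : Letter) → (ψ a ≡ 𝟘 ∷ []) ⊎ (Σ Letter λ b → ψ a ≡ 𝟘 ∷ b ∷ [])

zeroLed-gen : (g : Gen) → ZeroLed (gen g)
zeroLed-gen g₁ 𝟘 = inj₂ (𝟙 , refl)
zeroLed-gen g₁ 𝟙 = inj₁ refl
zeroLed-gen g₃ 𝟘 = inj₁ refl
zeroLed-gen g₃ 𝟙 = inj₂ (𝟙 , refl)

zeroLed-∷ʳ𝟘 : {ψ : Morphism} → ZeroLed ψ → (s : Word) →
              Σ Word λ s′ → apply ψ s ++ 𝟘 ∷ [] ≡ 𝟘 ∷ s′
zeroLed-∷ʳ𝟘 z []      = [] , refl
zeroLed-∷ʳ𝟘 {ψ} z (a ∷ s) with ψ a | z a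
... | .(𝟘 ∷ [])     | inj₁ refl       = (apply ψ s ++ 𝟘 ∷ []) , refl
... | .(𝟘 ∷ b ∷ []) | inj₂ (b , refl) = (b ∷ apply ψ s ++ 𝟘 ∷ []) , refl

-- Composing on the left with a zero-led morphism preserves balance.  The new
-- prefix is ψ(u) if ψ(c) = 0, and ψ(u) 0 if ψ(c) = 0b.
balanced-step : {ψ f : Morphism} → ZeroLed ψ → Balanced f → Balanced (ψ ∘ₘ f)
balanced-step {ψ} {f} z (u , c , f0≡uc , s , f1u≡us) with ψ c | z c | apply-∷ʳ ψ u c
... | .(𝟘 ∷ []) | inj₁ refl | ψuc≡ψu0 =
  apply ψ u , 𝟘 , trans (cong (apply ψ) f0≡uc) ψuc≡ψu0 ,
  apply ψ s , apply-preserves-++ ψ {f 𝟙} {u} {u} {s} f1u≡us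
... | .(𝟘 ∷ b ∷ []) | inj₂ (b , refl) | ψuc≡ψu0b with zeroLed-∷ʳ𝟘 z s
... | s′ , ψs0≡0s′ =
  apply ψ u ++ 𝟘 ∷ [] , b , image-𝟘 , s′ , image-𝟙
  where
  image-𝟘 : apply ψ (f 𝟘) ≡ (apply ψ u ++ 𝟘 ∷ []) ++ b ∷ []
  image-𝟘 = begin
    apply ψ (f 𝟘)                       ≡⟨ cong (apply ψ) f0≡uc ⟩
    apply ψ (u ++ c ∷ [])               ≡⟨ ψuc≡ψu0b ⟩
    apply ψ u ++ 𝟘 ∷ b ∷ []             ≡⟨ sym (++-assoc (apply ψ u) (𝟘 ∷ []) (b ∷ [])) ⟩
    (apply ψ u ++ 𝟘 ∷ []) ++ b ∷ []     ∎
  image-𝟙 : apply ψ (f 𝟙) ++ (apply ψ u ++ 𝟘 ∷ []) ≡ (apply ψ u ++ 𝟘 ∷ []) ++ s′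
  image-𝟙 = begin
    apply ψ (f 𝟙) ++ (apply ψ u ++ 𝟘 ∷ [])   ≡⟨ sym (++-assoc (apply ψ (f 𝟙)) (apply ψ u) _) ⟩
    (apply ψ (f 𝟙) ++ apply ψ u) ++ 𝟘 ∷ []   ≡⟨ cong (_++ 𝟘 ∷ []) (apply-preserves-++ ψ {f 𝟙} {u} {u} {s} f1u≡us) ⟩
    (apply ψ u ++ apply ψ s) ++ 𝟘 ∷ []       ≡⟨ ++-assoc (apply ψ u) (apply ψ s) _ ⟩
    apply ψ u ++ (apply ψ s ++ 𝟘 ∷ [])       ≡⟨ cong (apply ψ u ++_) ψs0≡0s′ ⟩
    apply ψ u ++ 𝟘 ∷ s′                      ≡⟨ sym (++-assoc (apply ψ u) (𝟘 ∷ []) s′) ⟩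
    (apply ψ u ++ 𝟘 ∷ []) ++ s′              ∎

balanced-eval : (gs : List Gen) → Balanced (eval gs)
balanced-eval []       = [] , 𝟘 , refl , 𝟙 ∷ [] , refl
balanced-eval (g ∷ gs) = balanced-step {gen g} {eval gs} (zeroLed-gen g) (balanced-eval gs)

balanced-M13 : {f : Morphism} → InM13 f → Balanced f
balanced-M13 {f} (gs , e0 , e1) with balanced-eval gs
... | u , c , f0≡uc , s , f1u≡us =
  u , c , trans (sym e0) f0≡uc , s , trans (cong (_++ u) (sym e1)) f1u≡us

conjugate-Ψ : {f : Morphism} → InM13 f → Conjugate f (prefixU f) (Ψ f)
conjugate-Ψ {f} f∈M with balanced-M13 {f} f∈M
... | u , c , f0≡uc , s , f1u≡us =
  conjugate-of-prefix {f} {prefixU f}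
    (subst (PrefixOfImages f) (sym (prefixU-∷ʳ {f} f0≡uc)) prefix)
  where
  prefix : PrefixOfImages f u
  prefix 𝟘 = c ∷ u , trans (cong (_++ u) f0≡uc) (++-assoc u (c ∷ []) u)
  prefix 𝟙 = s , f1u≡us

-- The prefix of a composite: if δ(0) = v 0 and γ(0) = u c, then
-- (γ ∘ δ)(0) = γ(v) u c, so prefixU (γ ∘ δ) = γ(prefixU δ) prefixU γ.
prefixU-∘ : {γ δ : Morphism} {u : Word} {c : Letter} →
            γ 𝟘 ≡ u ++ c ∷ [] → EndsWith0 (δ 𝟘) →
            prefixU (γ ∘ₘ δ) ≡ apply γ (prefixU δ) ++ prefixU γ
prefixU-∘ {γ} {δ} {u} {c} γ0≡uc (v , δ0≡v0) = begin
  prefixU (γ ∘ₘ δ)                        ≡⟨ prefixU-∷ʳ {γ ∘ₘ δ} composite-𝟘 ⟩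
  apply γ v ++ u                          ≡⟨ cong₂ (λ x y → apply γ x ++ y)
                                                   (sym (prefixU-∷ʳ {δ} δ0≡v0))
                                                   (sym (prefixU-∷ʳ {γ} γ0≡uc)) ⟩
  apply γ (prefixU δ) ++ prefixU γ        ∎
  where
  composite-𝟘 : apply γ (δ 𝟘) ≡ (apply γ v ++ u) ++ c ∷ []
  composite-𝟘 = begin
    apply γ (δ 𝟘)             ≡⟨ cong (apply γ) δ0≡v0 ⟩
    apply γ (v ++ 𝟘 ∷ [])     ≡⟨ apply-∷ʳ γ v 𝟘 ⟩
    apply γ v ++ γ 𝟘          ≡⟨ cong (apply γ v ++_) γ0≡uc ⟩
    apply γ v ++ (u ++ c ∷ []) ≡⟨ sym (++-assoc (apply γ v) u (c ∷ [])) ⟩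
    (apply γ v ++ u) ++ c ∷ [] ∎

proposition4 : (γ δ : Morphism) → InM13⁰ γ → InM13⁰ δ →
               (a : Letter) → Ψ (γ ∘ₘ δ) a ≡ (Ψ γ ∘ₘ Ψ δ) a
proposition4 γ δ (γ∈M , u , γ0≡u0) (δ∈M , δ0-ends-0) =
  conjugate-unique {γ ∘ₘ δ} composite-conjugate
  where
  composite-conjugate : Conjugate (γ ∘ₘ δ) (prefixU (γ ∘ₘ δ)) (Ψ γ ∘ₘ Ψ δ)
  composite-conjugate =
    subst (λ p → Conjugate (γ ∘ₘ δ) p (Ψ γ ∘ₘ Ψ δ))
          (sym (prefixU-∘ {γ} {δ} γ0≡u0 δ0-ends-0))
          (conjugate-∘ {γ} {Ψ γ} {δ} {Ψ δ} (conjugate-Ψ {γ} γ∈M) (conjugate-Ψ {δ} δ∈M))
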